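{- Let $t$ be a positive integer, let $d$ be a degree sequence of length $n$, and let $(a,b)\in\mathrm{BP}(d)$ with $a=(a_1,\dots,a_p)$ and $b=(b_1,\dots,b_q)$ non-increasing. If $a_1\cdot b_1\le \sum d/2+t+1$, then $(a,b)$ is $t$-tot-bigraphic.
   Context: A degree sequence is a non-increasing sequence of positive integers with even sum. $\mathrm{BP}(d)$ is the set of pairs $(a,b)$ of complementary subsequences of $d$ with equal sums. Multigraphs are loopless (parallel edges allowed). For a multigraph $H=(V,E)$, $\mathrm{TotMult}(H)=|E|-|E'|$ with $E'$ the edge set of the underlying simple graph. $(a,b)$ is $t$-tot-bigraphic if there is a loopless multigraph $H$ with underlying bipartite graph with sides $A,B$, where the degree sequence of $A$ is $a$, that of $B$ is $b$, and $\mathrm{TotMult}(H)\le t$. -}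

module Defs where

open import Data.Nat using (ℕ; zero; suc; _+_; _*_; _∸_; _≤_; _≥_; _<_)
open import Data.Nat.Divisibility using (_∣_)
open import Data.Fin using (Fin)
open import Data.List using (List; []; _∷_; length; tabulate; lookup)
open import Data.Nat.ListAction using (sum)
open import Data.List.Relation.Unary.All using (All)
open import Data.List.Relation.Unary.Linked using (Linked)
open import Data.List.Relation.Ternary.Interleaving.Propositional using (Interleaving)
open import Data.Product using (Σ; _×_)
open import Relation.Binary.PropositionalEquality using (_≡_)

Σ[_]_ : (n : ℕ) → (Fin n → ℕ) → ℕ
Σ[ n ] f = sum (tabulate f)

NonIncreasing : List ℕ → Set
NonIncreasing = Linked _≥_

record DegreeSequence (d : List ℕ) : Set where
  field
    nonIncreasing : NonIncreasing d
    positive      : All (λ x → 0 < x) d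
    evenSum       : 2 ∣ sum d

record BP (d a b : List ℕ) : Set where
  field
    complementary : Interleaving a b d
    equalSums     : sum a ≡ sum b

-- A loopless multigraph whose underlying graph is bipartite with sides
-- A = Fin p and B = Fin q, given by its edge multiplicities
-- M i j = number of parallel edges between i ∈ A and j ∈ B.
BipMultigraph : ℕ → ℕ → Set
BipMultigraph p q = Fin p → Fin q → ℕ

numEdges : ∀ {p q} → BipMultigraph p q → ℕ
numEdges {p} {q} M = Σ[ p ] (λ i → Σ[ q ] (λ j → M i j))

indicator : ℕ → ℕ
indicator zero    = 0
indicator (suc _) = 1

numSimpleEdges : ∀ {p q} → BipMultigraph p q → ℕ
numSimpleEdges {p} {q} M = Σ[ p ] (λ i → Σ[ q ] (λ j → indicator (M i j)))

TotMult : ∀ {p q} → BipMultigraph p q → ℕ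
TotMult M = numEdges M ∸ numSimpleEdges M

degA : ∀ {p q} → BipMultigraph p q → Fin p → ℕ
degA {p} {q} M i = Σ[ q ] (λ j → M i j)

degB : ∀ {p q} → BipMultigraph p q → Fin q → ℕ
degB {p} {q} M j = Σ[ p ] (λ i → M i j)


TotBigraphic : ℕ → List ℕ → List ℕ → Set
TotBigraphic t a b =
  Σ (BipMultigraph (length a) (length b)) λ M →
    ((i : Fin (length a)) → degA M i ≡ lookup a i) ×
    ((j : Fin (length b)) → degB M j ≡ lookup b j) ×
    (TotMult M ≤ t)

first : List ℕ → ℕ
first []      = 0
first (x ∷ _) = x

{-# OPTIONS --safe #-}
module Submission where

-- Strengthen the statement to admissible instances, in which A and B only bound the
-- degrees, and induct on the number of vertices; a vertex of degree 0 is simply dropped.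
-- Let A and B be the maximum degrees.  If A ≤ q (symmetrically if B ≤ p), a row of degree
-- A is joined by simple edges to A columns.  When at most A columns have degree B, all of
-- them are hit, so the bound B drops by one and A (B − 1) ≤ Σa′ + t + 1 survives; when more
-- than A columns have degree B ≥ A, already (A + 1) B ≤ Σb = A + Σa′ gives A B ≤ Σa′.  If
-- neither applies, B < A and (A + 1) B ≤ Σb = Σa ≤ p A force B ≤ p, and a column of degree
-- B is removed instead.  In the remaining case A > q and B > p: the simple staircase graph
-- F, with edge ij iff j is among the first a_i columns and i among the first b_j rows,
-- satisfies 2 Σa ≤ |F| + A B − (A − q) (B − p) ≤ |F| + Σa + t, and completing F by any
-- multigraph on the residual degrees adds at most Σa − |F| ≤ t surplus parallel edges.

open import Defs
open import Data.Fin using (Fin; zero; suc; toℕ; punchIn)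
open import Data.Fin.Properties using (any?)
open import Data.List using (List; length; lookup)
open import Data.List.Properties using (tabulate-cong; tabulate-lookup)
open import Data.List.Relation.Ternary.Interleaving.Propositional using (toPermutation)
open import Data.List.Relation.Unary.Linked using ([-]; _∷_)
open import Data.Nat
  using (ℕ; zero; suc; _+_; _*_; _∸_; _/_; _≤_; _<_; _⊓_; z≤n; s≤s; pred; _≤?_; _≟_)
open import Data.Nat.DivMod using (m*n/n≡m)
open import Data.Nat.ListAction using (sum)
open import Data.Nat.ListAction.Properties using (sum-++; sum-↭)
open import Data.Nat.Properties
open import Data.Nat.Solver using (module +-*-Solver)
open import Data.Product using (∃; ∃-syntax; _×_; _,_)
open import Data.Sum using (_⊎_; inj₁; inj₂; [_,_]′)
open import Data.Vec.Functional using (Vector; insertAt; removeAt; tail; transpose)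
open import Data.Vec.Functional.Properties using (insertAt-removeAt)
open import Function using (_∘_; id)
open import Relation.Binary.PropositionalEquality
open import Relation.Nullary using (Dec; yes; no; contradiction)
open import Relation.Nullary.Decidable using (_⊎-dec_)

open import Algebra.Properties.CommutativeSemigroup +-commutativeSemigroup
  using (interchange; x∙yz≈y∙xz)
open +-*-Solver using (solve; _:+_; _:*_; _:=_)

Σ-cong : ∀ n {f g : Fin n → ℕ} → (∀ i → f i ≡ g i) → Σ[ n ] f ≡ Σ[ n ] g
Σ-cong _ f≗g = cong sum (tabulate-cong f≗g)

Σ-mono-≤ : ∀ n {f g : Fin n → ℕ} → (∀ i → f i ≤ g i) → Σ[ n ] f ≤ Σ[ n ] g
Σ-mono-≤ zero    f≤g = z≤n
Σ-mono-≤ (suc n) f≤g = +-mono-≤ (f≤g zero) (Σ-mono-≤ n (f≤g ∘ suc))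

Σ-distrib-+ : ∀ n (f g : Fin n → ℕ) → Σ[ n ] (λ i → f i + g i) ≡ Σ[ n ] f + Σ[ n ] g
Σ-distrib-+ zero    f g = refl
Σ-distrib-+ (suc n) f g =
  trans (cong (f zero + g zero +_) (Σ-distrib-+ n (f ∘ suc) (g ∘ suc)))
        (interchange (f zero) (g zero) _ _)

Σ-const : ∀ n k → Σ[ n ] (λ _ → k) ≡ n * k
Σ-const zero    k = refl
Σ-const (suc n) k = cong (k +_) (Σ-const n k)

Σ-zero : ∀ n → Σ[ n ] (λ _ → 0) ≡ 0
Σ-zero n = trans (Σ-const n 0) (*-zeroʳ n)

Σ-ones : ∀ n → Σ[ n ] (λ _ → 1) ≡ n
Σ-ones n = trans (Σ-const n 1) (*-identityʳ n)

Σ-distribʳ-* : ∀ n (f : Fin n → ℕ) k → Σ[ n ] (λ i → f i * k) ≡ Σ[ n ] f * k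
Σ-distribʳ-* zero    f k = refl
Σ-distribʳ-* (suc n) f k = trans (cong (f zero * k +_) (Σ-distribʳ-* n (f ∘ suc) k))
                                 (sym (*-distribʳ-+ k (f zero) _))

Σ-comm : ∀ p q (f : Fin p → Fin q → ℕ) →
         Σ[ p ] (λ i → Σ[ q ] (f i)) ≡ Σ[ q ] (λ j → Σ[ p ] (λ i → f i j))
Σ-comm zero    q f = sym (Σ-zero q)
Σ-comm (suc p) q f = trans (cong (Σ[ q ] (f zero) +_) (Σ-comm p q (f ∘ suc)))
                           (sym (Σ-distrib-+ q (f zero) _))

Σ-∸ : ∀ n {f g : Fin n → ℕ} → (∀ i → g i ≤ f i) →
      Σ[ n ] (λ i → f i ∸ g i) ≡ Σ[ n ] f ∸ Σ[ n ] g
Σ-∸ n {f} {g} g≤f = begin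
  Σ[ n ] (λ i → f i ∸ g i)                        ≡⟨ m+n∸n≡m _ (Σ[ n ] g) ⟨
  Σ[ n ] (λ i → f i ∸ g i) + Σ[ n ] g ∸ Σ[ n ] g  ≡⟨ cong (_∸ Σ[ n ] g) (Σ-distrib-+ n _ g) ⟨
  Σ[ n ] (λ i → f i ∸ g i + g i) ∸ Σ[ n ] g       ≡⟨ cong (_∸ Σ[ n ] g) (Σ-cong n f∸g+g≡f) ⟩
  Σ[ n ] f ∸ Σ[ n ] g                             ∎
  where
  open ≡-Reasoning
  f∸g+g≡f : ∀ i → f i ∸ g i + g i ≡ f i
  f∸g+g≡f i = m∸n+n≡m (g≤f i)

term≤Σ : ∀ n (f : Fin n → ℕ) i → f i ≤ Σ[ n ] f
term≤Σ (suc n) f zero    = m≤m+n (f zero) _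
term≤Σ (suc n) f (suc i) = ≤-trans (term≤Σ n (f ∘ suc) i) (m≤n+m _ (f zero))

Σ-insertAt : ∀ {A : Set} n (g : A → ℕ) (xs : Vector A n) i v →
             Σ[ suc n ] (g ∘ insertAt xs i v) ≡ g v + Σ[ n ] (g ∘ xs)
Σ-insertAt n       g xs zero    v = refl
Σ-insertAt (suc n) g xs (suc i) v =
  trans (cong (g (xs zero) +_) (Σ-insertAt n g (tail xs) i v)) (x∙yz≈y∙xz (g (xs zero)) (g v) _)

Σ-removeAt : ∀ n (f : Fin (suc n) → ℕ) i → Σ[ suc n ] f ≡ f i + Σ[ n ] (removeAt f i)
Σ-removeAt n f i = trans (Σ-cong (suc n) (λ k → sym (insertAt-removeAt f i k)))
                         (Σ-insertAt n id (removeAt f i) i (f i))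

map-insertAt : ∀ {A B : Set} {n} (f : A → B) (xs : Vector A n) i {v} {ys : Vector B (suc n)} →
               f v ≡ ys i → (∀ k → f (xs k) ≡ removeAt ys i k) →
               ∀ k → f (insertAt xs i v k) ≡ ys k
map-insertAt f xs zero fv≡ fxs≡ zero    = fv≡
map-insertAt f xs zero fv≡ fxs≡ (suc k) = fxs≡ k
map-insertAt {n = suc n} f xs (suc i) fv≡ fxs≡ zero    = fxs≡ zero
map-insertAt {n = suc n} f xs (suc i) fv≡ fxs≡ (suc k) =
  map-insertAt f (tail xs) i fv≡ (fxs≡ ∘ suc) k

fill : ∀ q (s : Fin q → ℕ) k → k ≤ Σ[ q ] s → ∃[ c ] (∀ j → c j ≤ s j) × Σ[ q ] c ≡ k
fill zero    s zero k≤ = (λ ()) , (λ ()) , refl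
fill (suc q) s k    k≤ with fill q (s ∘ suc) (k ∸ s zero) (m≤n+o⇒m∸n≤o k (s zero) k≤)
... | c , c≤s , Σc≡ =
  c′ , c′≤s , trans (cong (s zero ⊓ k +_) Σc≡) (m⊓n+n∸m≡n (s zero) k)
  where
  c′ : Fin (suc q) → ℕ
  c′ zero    = s zero ⊓ k
  c′ (suc j) = c j
  c′≤s : ∀ j → c′ j ≤ s j
  c′≤s zero    = m⊓n≤m (s zero) k
  c′≤s (suc j) = c≤s j

fill-between : ∀ q (e s : Fin q → ℕ) {k} → (∀ j → e j ≤ s j) → Σ[ q ] e ≤ k → k ≤ Σ[ q ] s →
               ∃[ c ] (∀ j → e j ≤ c j) × (∀ j → c j ≤ s j) × Σ[ q ] c ≡ k
fill-between q e s {k} e≤s Σe≤k k≤Σs with fill q (λ j → s j ∸ e j) (k ∸ Σ[ q ] e) room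
  where
  room : k ∸ Σ[ q ] e ≤ Σ[ q ] (λ j → s j ∸ e j)
  room = subst (k ∸ Σ[ q ] e ≤_) (sym (Σ-∸ q e≤s)) (∸-monoˡ-≤ (Σ[ q ] e) k≤Σs)
... | f , f≤ , Σf≡ =
  (λ j → e j + f j) ,
  (λ j → m≤m+n (e j) (f j)) ,
  (λ j → ≤-trans (+-monoʳ-≤ (e j) (f≤ j)) (≤-reflexive (m+[n∸m]≡n (e≤s j)))) ,
  trans (Σ-distrib-+ q e f) (trans (cong (Σ[ q ] e +_) Σf≡) (m+[n∸m]≡n Σe≤k))

-- Unlike TotMult, this is a sum over vertex pairs, hence additive.
excess : ∀ {p q} → BipMultigraph p q → ℕ
excess {p} {q} M = Σ[ p ] (λ i → Σ[ q ] (λ j → pred (M i j)))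

pred[n]+indicator[n]≡n : ∀ n → pred n + indicator n ≡ n
pred[n]+indicator[n]≡n zero    = refl
pred[n]+indicator[n]≡n (suc n) = +-comm n 1

TotMult≡excess : ∀ {p q} (M : BipMultigraph p q) → TotMult M ≡ excess M
TotMult≡excess {p} {q} M = begin
  numEdges M ∸ numSimpleEdges M                   ≡⟨ cong (_∸ numSimpleEdges M) numEdges≡ ⟩
  excess M + numSimpleEdges M ∸ numSimpleEdges M  ≡⟨ m+n∸n≡m (excess M) (numSimpleEdges M) ⟩
  excess M                                        ∎
  where
  open ≡-Reasoning
  numEdges≡ : numEdges M ≡ excess M + numSimpleEdges M
  numEdges≡ = begin
    Σ[ p ] (λ i → Σ[ q ] (M i))
      ≡⟨ Σ-cong p (λ i → Σ-cong q (λ j → pred[n]+indicator[n]≡n (M i j))) ⟨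
    Σ[ p ] (λ i → Σ[ q ] (λ j → pred (M i j) + indicator (M i j)))
      ≡⟨ Σ-cong p (λ i → Σ-distrib-+ q _ _) ⟩
    Σ[ p ] (λ i → Σ[ q ] (λ j → pred (M i j)) + Σ[ q ] (λ j → indicator (M i j)))
      ≡⟨ Σ-distrib-+ p _ _ ⟩
    excess M + numSimpleEdges M
      ∎

Realizes : ∀ {p q} → BipMultigraph p q → (Fin p → ℕ) → (Fin q → ℕ) → Set
Realizes M a b = (∀ i → degA M i ≡ a i) × (∀ j → degB M j ≡ b j)

Realizable : ∀ {p q} → ℕ → (Fin p → ℕ) → (Fin q → ℕ) → Set
Realizable t a b = ∃[ M ] Realizes M a b × excess M ≤ t

Realizable-transpose : ∀ {p q t} {a : Fin p → ℕ} {b : Fin q → ℕ} →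
                       Realizable t b a → Realizable t a b
Realizable-transpose {p} {q} {t} (M , (degA≡ , degB≡) , excess≤) =
  transpose M , (degB≡ , degA≡) , subst (_≤ t) (Σ-comm q p (λ j i → pred (M j i))) excess≤

Realizes-insertAt : ∀ {p q} {a : Fin (suc p) → ℕ} {b : Fin q → ℕ} {M : BipMultigraph p q} i {c} →
                    (∀ j → c j ≤ b j) → Σ[ q ] c ≡ a i →
                    Realizes M (removeAt a i) (λ j → b j ∸ c j) → Realizes (insertAt M i c) a b
Realizes-insertAt {p} {q} {a} {b} {M} i {c} c≤b Σc≡ (degA≡ , degB≡) =
  map-insertAt (λ row → Σ[ q ] row) M i Σc≡ degA≡ , degB-insertAt
  where
  open ≡-Reasoning
  degB-insertAt : ∀ j → degB (insertAt M i c) j ≡ b j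
  degB-insertAt j = begin
    degB (insertAt M i c) j  ≡⟨ Σ-insertAt p (λ row → row j) M i c ⟩
    c j + degB M j           ≡⟨ cong (c j +_) (degB≡ j) ⟩
    c j + (b j ∸ c j)        ≡⟨ m+[n∸m]≡n (c≤b j) ⟩
    b j                      ∎

excess-insertAt : ∀ {p q} (M : BipMultigraph p q) i c →
                  excess (insertAt M i c) ≡ Σ[ q ] (pred ∘ c) + excess M
excess-insertAt {p} {q} M i c = Σ-insertAt p (λ row → Σ[ q ] (pred ∘ row)) M i c

Σ-removeAt-balanced : ∀ {p q} (a : Fin (suc p) → ℕ) {b c : Fin q → ℕ} →
                      Σ[ suc p ] a ≡ Σ[ q ] b → ∀ i → (∀ j → c j ≤ b j) → Σ[ q ] c ≡ a i →
                      Σ[ p ] (removeAt a i) ≡ Σ[ q ] (λ j → b j ∸ c j)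
Σ-removeAt-balanced {p} {q} a {b} {c} Σa≡Σb i c≤b Σc≡ = begin
  Σ[ p ] (removeAt a i)              ≡⟨ m+n∸m≡n (a i) _ ⟨
  a i + Σ[ p ] (removeAt a i) ∸ a i  ≡⟨ cong₂ _∸_ (trans (sym (Σ-removeAt p a i)) Σa≡Σb) (sym Σc≡) ⟩
  Σ[ q ] b ∸ Σ[ q ] c                ≡⟨ Σ-∸ q c≤b ⟨
  Σ[ q ] (λ j → b j ∸ c j)           ∎
  where open ≡-Reasoning

realize : ∀ p q (a : Fin p → ℕ) (b : Fin q → ℕ) → Σ[ p ] a ≡ Σ[ q ] b → ∃[ M ] Realizes M a b
realize zero q a b Σa≡Σb =
  (λ ()) , (λ ()) , λ j → sym (n≤0⇒n≡0 (subst (b j ≤_) (sym Σa≡Σb) (term≤Σ q b j)))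
realize (suc p) q a b Σa≡Σb with fill q b (a zero) (subst (a zero ≤_) Σa≡Σb (m≤m+n (a zero) _))
... | c , c≤b , Σc≡
  with realize p q (a ∘ suc) (λ j → b j ∸ c j) (Σ-removeAt-balanced a Σa≡Σb zero c≤b Σc≡)
... | M , realizes = insertAt M zero c , Realizes-insertAt zero c≤b Σc≡ realizes

insertRow : ∀ {p q t} {a : Fin (suc p) → ℕ} {b : Fin q → ℕ} i {c} →
            (∀ j → c j ≤ 1) → (∀ j → c j ≤ b j) → Σ[ q ] c ≡ a i →
            Realizable t (removeAt a i) (λ j → b j ∸ c j) → Realizable t a b
insertRow {q = q} {t} i {c} c≤1 c≤b Σc≡ (M , realizes , excess≤) =
  insertAt M i c , Realizes-insertAt i c≤b Σc≡ realizes , excess≤′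
  where
  Σpred≤0 : Σ[ q ] (pred ∘ c) ≤ 0
  Σpred≤0 = ≤-trans (Σ-mono-≤ q (λ j → pred-mono-≤ (c≤1 j))) (≤-reflexive (Σ-zero q))
  excess≤′ : excess (insertAt M i c) ≤ t
  excess≤′ = subst (_≤ t) (sym (excess-insertAt M i c)) (+-mono-≤ Σpred≤0 excess≤)

pred[m+n]≤n : ∀ {m} n → m ≤ 1 → pred (m + n) ≤ n
pred[m+n]≤n n z≤n       = pred[n]≤n
pred[m+n]≤n n (s≤s z≤n) = ≤-refl

simple⇒realizable : ∀ {p q t} {a : Fin p → ℕ} {b : Fin q → ℕ} (F : BipMultigraph p q) →
                    (∀ i j → F i j ≤ 1) → (∀ i → degA F i ≤ a i) → (∀ j → degB F j ≤ b j) →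
                    Σ[ p ] a ≡ Σ[ q ] b → Σ[ p ] a ≤ numEdges F + t → Realizable t a b
simple⇒realizable {p} {q} {t} {a} {b} F F≤1 degA≤ degB≤ Σa≡Σb Σa≤ =
  extend (realize p q (λ i → a i ∸ degA F i) (λ j → b j ∸ degB F j) residual-balanced)
  where
  open ≤-Reasoning
  residual-balanced : Σ[ p ] (λ i → a i ∸ degA F i) ≡ Σ[ q ] (λ j → b j ∸ degB F j)
  residual-balanced = begin-equality
    Σ[ p ] (λ i → a i ∸ degA F i)  ≡⟨ Σ-∸ p degA≤ ⟩
    Σ[ p ] a ∸ numEdges F          ≡⟨ cong₂ _∸_ Σa≡Σb (Σ-comm p q F) ⟩
    Σ[ q ] b ∸ Σ[ q ] (degB F)     ≡⟨ Σ-∸ q degB≤ ⟨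
    Σ[ q ] (λ j → b j ∸ degB F j)  ∎
  extend : ∃[ N ] Realizes N (λ i → a i ∸ degA F i) (λ j → b j ∸ degB F j) → Realizable t a b
  extend (N , (degA-N , degB-N)) = M , (degA-M , degB-M) , excess-M
    where
    M : BipMultigraph p q
    M i j = F i j + N i j
    degA-M : ∀ i → degA M i ≡ a i
    degA-M i = trans (Σ-distrib-+ q (F i) (N i))
                     (trans (cong (degA F i +_) (degA-N i)) (m+[n∸m]≡n (degA≤ i)))
    degB-M : ∀ j → degB M j ≡ b j
    degB-M j = trans (Σ-distrib-+ p (λ i → F i j) (λ i → N i j))
                     (trans (cong (degB F j +_) (degB-N j)) (m+[n∸m]≡n (degB≤ j)))
    excess-M : excess M ≤ t
    excess-M = begin
      excess M
        ≤⟨ Σ-mono-≤ p (λ i → Σ-mono-≤ q (λ j → pred[m+n]≤n (N i j) (F≤1 i j))) ⟩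
      Σ[ p ] (degA N)                ≡⟨ Σ-cong p degA-N ⟩
      Σ[ p ] (λ i → a i ∸ degA F i)  ≡⟨ Σ-∸ p degA≤ ⟩
      Σ[ p ] a ∸ numEdges F          ≤⟨ m≤n+o⇒m∸n≤o (Σ[ p ] a) (numEdges F) Σa≤ ⟩
      t                              ∎

indicator≤1 : ∀ n → indicator n ≤ 1
indicator≤1 zero    = z≤n
indicator≤1 (suc n) = ≤-refl

indicator+indicator≤⊓+1 : ∀ m n → indicator m + indicator n ≤ indicator m ⊓ indicator n + 1
indicator+indicator≤⊓+1 zero    n       = indicator≤1 n
indicator+indicator≤⊓+1 (suc m) zero    = ≤-refl
indicator+indicator≤⊓+1 (suc m) (suc n) = ≤-refl

Σ-indicator[k∸toℕ] : ∀ n k → Σ[ n ] (λ j → indicator (k ∸ toℕ j)) ≡ n ⊓ k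
Σ-indicator[k∸toℕ] zero    k       = refl
Σ-indicator[k∸toℕ] (suc n) zero    = Σ-zero n
Σ-indicator[k∸toℕ] (suc n) (suc k) = cong suc (Σ-indicator[k∸toℕ] n k)

staircase : ∀ p q (a : Fin p → ℕ) (b : Fin q → ℕ) →
            ∃[ F ] (∀ i j → F i j ≤ 1) ×
                   (∀ i → degA F i ≤ q ⊓ a i) × (∀ j → degB F j ≤ p ⊓ b j) ×
                   Σ[ p ] (λ i → q ⊓ a i) + Σ[ q ] (λ j → p ⊓ b j) ≤ numEdges F + p * q
staircase p q a b = F , F≤1 , degA≤ , degB≤ , size
  where
  open ≤-Reasoning
  -- indicator (k ∸ x) is 1 exactly when x < k.
  row col F : BipMultigraph p q
  row i j = indicator (a i ∸ toℕ j)
  col i j = indicator (b j ∸ toℕ i)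
  F i j = row i j ⊓ col i j
  F≤1 : ∀ i j → F i j ≤ 1
  F≤1 i j = ≤-trans (m⊓n≤m (row i j) (col i j)) (indicator≤1 _)
  degA≤ : ∀ i → degA F i ≤ q ⊓ a i
  degA≤ i = begin
    degA F i            ≤⟨ Σ-mono-≤ q (λ j → m⊓n≤m (row i j) (col i j)) ⟩
    Σ[ q ] (row i)      ≡⟨ Σ-indicator[k∸toℕ] q (a i) ⟩
    q ⊓ a i             ∎
  degB≤ : ∀ j → degB F j ≤ p ⊓ b j
  degB≤ j = begin
    degB F j                     ≤⟨ Σ-mono-≤ p (λ i → m⊓n≤n (row i j) (col i j)) ⟩
    Σ[ p ] (λ i → col i j)       ≡⟨ Σ-indicator[k∸toℕ] p (b j) ⟩
    p ⊓ b j                      ∎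
  size : Σ[ p ] (λ i → q ⊓ a i) + Σ[ q ] (λ j → p ⊓ b j) ≤ numEdges F + p * q
  size = begin
    Σ[ p ] (λ i → q ⊓ a i) + Σ[ q ] (λ j → p ⊓ b j)
      ≡⟨ cong₂ _+_ (Σ-cong p (λ i → Σ-indicator[k∸toℕ] q (a i)))
                   (trans (Σ-comm p q col) (Σ-cong q (λ j → Σ-indicator[k∸toℕ] p (b j)))) ⟨
    Σ[ p ] (λ i → Σ[ q ] (row i)) + Σ[ p ] (λ i → Σ[ q ] (col i))
      ≡⟨ trans (Σ-cong p (λ i → Σ-distrib-+ q (row i) (col i))) (Σ-distrib-+ p _ _) ⟨
    Σ[ p ] (λ i → Σ[ q ] (λ j → row i j + col i j))
      ≤⟨ Σ-mono-≤ p (λ i → Σ-mono-≤ q (λ j → indicator+indicator≤⊓+1 _ _)) ⟩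
    Σ[ p ] (λ i → Σ[ q ] (λ j → F i j + 1))
      ≡⟨ trans (Σ-cong p (λ i → Σ-distrib-+ q (F i) (λ _ → 1))) (Σ-distrib-+ p _ _) ⟩
    numEdges F + Σ[ p ] (λ _ → Σ[ q ] (λ _ → 1))
      ≡⟨ cong (numEdges F +_) (trans (Σ-const p _) (cong (p *_) (Σ-ones q))) ⟩
    numEdges F + p * q
      ∎

Σf≤Σ[k⊓f]+n*[M∸k] : ∀ n (f : Fin n → ℕ) {M} → (∀ i → f i ≤ M) → ∀ k →
                     Σ[ n ] f ≤ Σ[ n ] (λ i → k ⊓ f i) + n * (M ∸ k)
Σf≤Σ[k⊓f]+n*[M∸k] n f {M} f≤M k = begin
  Σ[ n ] f
    ≡⟨ Σ-cong n (λ i → m⊓n+n∸m≡n k (f i)) ⟨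
  Σ[ n ] (λ i → k ⊓ f i + (f i ∸ k))
    ≤⟨ Σ-mono-≤ n (λ i → +-monoʳ-≤ (k ⊓ f i) (∸-monoˡ-≤ k (f≤M i))) ⟩
  Σ[ n ] (λ i → k ⊓ f i + (M ∸ k))
    ≡⟨ Σ-distrib-+ n _ _ ⟩
  Σ[ n ] (λ i → k ⊓ f i) + Σ[ n ] (λ _ → M ∸ k)
    ≡⟨ cong (Σ[ n ] (λ i → k ⊓ f i) +_) (Σ-const n (M ∸ k)) ⟩
  Σ[ n ] (λ i → k ⊓ f i) + n * (M ∸ k)
    ∎
  where open ≤-Reasoning

staircase-arith : ∀ {S E U V p q α β t} →
                  S ≤ U + p * α → S ≤ V + q * β → U + V ≤ E + p * q →
                  (q + α) * (p + β) ≤ S + t + 1 → 1 ≤ α * β → S ≤ E + t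
staircase-arith {S} {E} {U} {V} {p} {q} {α} {β} {t} S≤U+ S≤V+ U+V≤ product≤ 1≤αβ =
  +-cancelˡ-≤ S S (E + t) (begin
    S + S                          ≤⟨ +-mono-≤ S≤U+ S≤V+ ⟩
    (U + p * α) + (V + q * β)      ≡⟨ interchange U (p * α) V (q * β) ⟩
    (U + V) + (p * α + q * β)      ≤⟨ +-monoˡ-≤ (p * α + q * β) U+V≤ ⟩
    (E + p * q) + (p * α + q * β)  ≡⟨ trans (+-assoc E (p * q) _)
                                           (cong (E +_) (sym (+-assoc (p * q) _ _))) ⟩
    E + X                          ≤⟨ +-monoʳ-≤ E X≤S+t ⟩
    E + (S + t)                    ≡⟨ x∙yz≈y∙xz E S t ⟩
    S + (E + t)                    ∎)
  where
  open ≤-Reasoning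
  X = p * q + p * α + q * β
  X≤S+t : X ≤ S + t
  X≤S+t = +-cancelʳ-≤ 1 X (S + t) (begin
    X + 1              ≤⟨ +-monoʳ-≤ X 1≤αβ ⟩
    X + α * β          ≡⟨ solve 4 (λ p q α β → (q :+ α) :* (p :+ β) :=
                                               p :* q :+ p :* α :+ q :* β :+ α :* β) refl p q α β ⟨
    (q + α) * (p + β)  ≤⟨ product≤ ⟩
    S + t + 1          ∎)

-- A and B only bound the degrees, so that admissibility survives deleting a vertex.
record Admissible (t p q : ℕ) : Set where
  field
    a        : Fin p → ℕ
    b        : Fin q → ℕ
    balanced : Σ[ p ] a ≡ Σ[ q ] b
    A B      : ℕ
    a≤A      : ∀ i → a i ≤ A
    b≤B      : ∀ j → b j ≤ B
    A*B≤     : A * B ≤ Σ[ p ] a + t + 1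

AdmissibleRealizable : ℕ → ℕ → ℕ → Set
AdmissibleRealizable t p q = (I : Admissible t p q) → Realizable t (Admissible.a I) (Admissible.b I)

swap : ∀ {t p q} → Admissible t p q → Admissible t q p
swap {t} I = record
  { a = b ; b = a ; balanced = sym balanced ; A = B ; B = A ; a≤A = b≤B ; b≤B = a≤A
  ; A*B≤ = subst₂ (λ x y → x ≤ y + t + 1) (*-comm A B) balanced A*B≤ }
  where open Admissible I

tighten : ∀ {t p q} (I : Admissible t p q) → let open Admissible I in
          ∀ i → (∀ k → a k ≤ a i) → ∀ j → (∀ k → b k ≤ b j) → Admissible t p q
tighten I i a≤ai j b≤bj = record I
  { A = a i ; B = b j ; a≤A = a≤ai ; b≤B = b≤bj
  ; A*B≤ = ≤-trans (*-mono-≤ (a≤A i) (b≤B j)) A*B≤ }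
  where open Admissible I

large⇒realizable : ∀ {t p q} (I : Admissible t p q) → let open Admissible I in
                   q < A → p < B → Realizable t a b
large⇒realizable {t} {p} {q} I q<A p<B with staircase p q a b
  where open Admissible I
... | F , F≤1 , degA≤ , degB≤ , size =
  simple⇒realizable F F≤1 (λ i → ≤-trans (degA≤ i) (m⊓n≤n q (a i)))
                          (λ j → ≤-trans (degB≤ j) (m⊓n≤n p (b j))) balanced
    (staircase-arith {p = p} {q} {A ∸ q} {B ∸ p} Σa≤ Σb≤ size product≤
                     (*-mono-≤ (m<n⇒0<n∸m q<A) (m<n⇒0<n∸m p<B)))
  where
  open Admissible I
  Σa≤ : Σ[ p ] a ≤ Σ[ p ] (λ i → q ⊓ a i) + p * (A ∸ q)
  Σa≤ = Σf≤Σ[k⊓f]+n*[M∸k] p a a≤A q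
  Σb≤ : Σ[ p ] a ≤ Σ[ q ] (λ j → p ⊓ b j) + q * (B ∸ p)
  Σb≤ = subst (_≤ Σ[ q ] (λ j → p ⊓ b j) + q * (B ∸ p)) (sym balanced)
              (Σf≤Σ[k⊓f]+n*[M∸k] q b b≤B p)
  product≤ : (q + (A ∸ q)) * (p + (B ∸ p)) ≤ Σ[ p ] a + t + 1
  product≤ = subst₂ (λ x y → x * y ≤ Σ[ p ] a + t + 1)
                    (sym (m+[n∸m]≡n (<⇒≤ q<A))) (sym (m+[n∸m]≡n (<⇒≤ p<B))) A*B≤

χ : ∀ {P : Set} → Dec P → ℕ
χ (yes _) = 1
χ (no _)  = 0

χ≤1 : ∀ {P : Set} (P? : Dec P) → χ P? ≤ 1
χ≤1 (yes _) = ≤-refl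
χ≤1 (no _)  = z≤n

count : ∀ {q} → (Fin q → ℕ) → ℕ → ℕ
count {q} b B = Σ[ q ] (λ j → χ (b j ≟ B))

count*≤Σ : ∀ q (b : Fin q → ℕ) B → count b B * B ≤ Σ[ q ] b
count*≤Σ q b B = ≤-trans (≤-reflexive (sym (Σ-distribʳ-* q _ B))) (Σ-mono-≤ q term≤)
  where
  term≤ : ∀ j → χ (b j ≟ B) * B ≤ b j
  term≤ j with b j ≟ B
  ... | yes bj≡B = ≤-reflexive (trans (+-identityʳ B) (sym bj≡B))
  ... | no _     = z≤n

x∸[x≡B]≤B∸1 : ∀ {x B} → x ≤ B → x ∸ χ (x ≟ B) ≤ B ∸ 1
x∸[x≡B]≤B∸1 {x} {B} x≤B with x ≟ B
... | yes refl = ≤-refl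
... | no x≢B   = ∸-monoˡ-≤ 1 (≤∧≢⇒< x≤B x≢B)

removeRow : ∀ {t p q} → AdmissibleRealizable t p q →
            (I : Admissible t (suc p) q) → let open Admissible I in
            ∀ i {c} → (∀ j → c j ≤ 1) → (∀ j → c j ≤ b j) → Σ[ q ] c ≡ a i →
            ∀ B′ → (∀ j → b j ∸ c j ≤ B′) → A * B′ ≤ Σ[ p ] (removeAt a i) + t + 1 →
            Realizable t a b
removeRow ih I i {c} c≤1 c≤b Σc≡ B′ b∸c≤B′ A*B′≤ = insertRow i c≤1 c≤b Σc≡ (ih reduced)
  where
  open Admissible I
  reduced : Admissible _ _ _
  reduced = record
    { a = removeAt a i ; b = λ j → b j ∸ c j
    ; balanced = Σ-removeAt-balanced a balanced i c≤b Σc≡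
    ; A = A ; B = B′ ; a≤A = a≤A ∘ punchIn i ; b≤B = b∸c≤B′ ; A*B≤ = A*B′≤ }

removeZeroRow : ∀ {t p q} → AdmissibleRealizable t p q →
                (I : Admissible t (suc p) q) → let open Admissible I in
                ∀ i → a i ≡ 0 → Realizable t a b
removeZeroRow {t} {p} {q} ih I i ai≡0 =
  removeRow ih I i (λ _ → z≤n) (λ _ → z≤n) (trans (Σ-zero q) (sym ai≡0)) B b≤B
            (subst (λ x → A * B ≤ x + t + 1) Σa≡Σa′ A*B≤)
  where
  open Admissible I
  Σa≡Σa′ : Σ[ suc p ] a ≡ Σ[ p ] (removeAt a i)
  Σa≡Σa′ = trans (Σ-removeAt p a i) (cong (_+ Σ[ p ] (removeAt a i)) ai≡0)

m*n≤m+o⇒m*[n∸1]≤o : ∀ m n {o} → m * n ≤ m + o → m * (n ∸ 1) ≤ o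
m*n≤m+o⇒m*[n∸1]≤o m zero        _    = ≤-trans (≤-reflexive (*-zeroʳ m)) z≤n
m*n≤m+o⇒m*[n∸1]≤o m (suc n) {o} m*n≤ = +-cancelˡ-≤ m _ _ (subst (_≤ m + o) (*-suc m n) m*n≤)

suc[m]*n≤m+o⇒m*n≤o : ∀ {m n o} → m ≤ n → suc m * n ≤ m + o → m * n ≤ o
suc[m]*n≤m+o⇒m*n≤o {m} {n} m≤n suc[m]*n≤ =
  +-cancelˡ-≤ m _ _ (≤-trans (+-monoˡ-≤ (m * n) m≤n) suc[m]*n≤)

removeMaxRow : ∀ {t p q} → AdmissibleRealizable t p q →
               (I : Admissible t (suc p) q) → let open Admissible I in
               ∀ i → a i ≡ A → (∀ j → 0 < b j) → A ≤ q → count b B ≤ A ⊎ A ≤ B →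
               Realizable t a b
removeMaxRow {t} {p} {q} ih I i ai≡A b>0 A≤q fits = byCount (count b B ≤? A)
  where
  open Admissible I
  A≤Σ1 : A ≤ Σ[ q ] (λ _ → 1)
  A≤Σ1 = subst (A ≤_) (sym (Σ-ones q)) A≤q
  simple≤b : ∀ {c : Fin q → ℕ} → (∀ j → c j ≤ 1) → ∀ j → c j ≤ b j
  simple≤b c≤1 j = ≤-trans (c≤1 j) (b>0 j)
  Σa≡A+Σa′ : Σ[ suc p ] a ≡ A + Σ[ p ] (removeAt a i)
  Σa≡A+Σa′ = trans (Σ-removeAt p a i) (cong (_+ Σ[ p ] (removeAt a i)) ai≡A)
  Σa+t+1≡ : Σ[ suc p ] a + t + 1 ≡ A + (Σ[ p ] (removeAt a i) + t + 1)
  Σa+t+1≡ = trans (cong (λ x → x + t + 1) Σa≡A+Σa′)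
                  (trans (cong (_+ 1) (+-assoc A _ t)) (+-assoc A _ 1))
  byCount : Dec (count b B ≤ A) → Realizable t a b
  byCount (yes count≤A)
    with fill-between q (λ j → χ (b j ≟ B)) (λ _ → 1) (λ j → χ≤1 (b j ≟ B)) count≤A A≤Σ1
  ... | c , e≤c , c≤1 , Σc≡A =
    removeRow ih I i c≤1 (simple≤b c≤1) (trans Σc≡A (sym ai≡A)) (B ∸ 1)
              (λ j → ≤-trans (∸-monoʳ-≤ (b j) (e≤c j)) (x∸[x≡B]≤B∸1 (b≤B j)))
              (m*n≤m+o⇒m*[n∸1]≤o A B (≤-trans A*B≤ (≤-reflexive Σa+t+1≡)))
  byCount (no count≰A) with fill q (λ _ → 1) A A≤Σ1
  ... | c , c≤1 , Σc≡A =
    removeRow ih I i c≤1 (simple≤b c≤1) (trans Σc≡A (sym ai≡A)) B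
              (λ j → ≤-trans (m∸n≤m (b j) (c j)) (b≤B j))
              (≤-trans (suc[m]*n≤m+o⇒m*n≤o A≤B suc[A]*B≤) (≤-trans (m≤m+n _ t) (m≤m+n _ 1)))
    where
    A≤B : A ≤ B
    A≤B = [ (λ count≤A → contradiction count≤A count≰A) , id ]′ fits
    suc[A]*B≤ : suc A * B ≤ A + Σ[ p ] (removeAt a i)
    suc[A]*B≤ = begin
      suc A * B                  ≤⟨ *-monoˡ-≤ B (≰⇒> count≰A) ⟩
      count b B * B              ≤⟨ count*≤Σ q b B ⟩
      Σ[ q ] b                   ≡⟨ balanced ⟨
      Σ[ suc p ] a               ≡⟨ Σa≡A+Σa′ ⟩
      A + Σ[ p ] (removeAt a i)  ∎
      where open ≤-Reasoning

suc[m]*n≤o*m⇒n≤o : ∀ {m n o} → suc m * n ≤ o * m → n ≤ o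
suc[m]*n≤o*m⇒n≤o {m} {n} {o} suc[m]*n≤o*m = ≮⇒≥ λ o<n → <-irrefl refl (begin-strict
  o * m          ≡⟨ *-comm o m ⟩
  m * o          ≤⟨ *-monoʳ-≤ m (n≤1+n o) ⟩
  m * suc o      ≤⟨ m≤n+m (m * suc o) o ⟩
  o + m * suc o  <⟨ n<1+n _ ⟩
  suc m * suc o  ≤⟨ *-monoʳ-≤ (suc m) o<n ⟩
  suc m * n      ≤⟨ suc[m]*n≤o*m ⟩
  o * m          ∎)
  where open ≤-Reasoning

removeMaxRowOrColumn : ∀ {t p q} →
                       AdmissibleRealizable t p (suc q) → AdmissibleRealizable t q (suc p) →
                       (I : Admissible t (suc p) (suc q)) → let open Admissible I in
                       ∀ i → a i ≡ A → ∀ j → b j ≡ B → (∀ i → 0 < a i) → (∀ j → 0 < b j) →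
                       A ≤ suc q → Realizable t a b
removeMaxRowOrColumn {t} {p} {q} ihRow ihCol I i ai≡A j bj≡B a>0 b>0 A≤q
  with (count b B ≤? A) ⊎-dec (A ≤? B)
  where open Admissible I
... | yes fits = removeMaxRow ihRow I i ai≡A b>0 A≤q fits
... | no ¬fits =
  Realizable-transpose (removeMaxRow ihCol (swap I) j bj≡B a>0 B≤p (inj₂ (<⇒≤ B<A)))
  where
  open Admissible I
  open ≤-Reasoning
  B<A : B < A
  B<A = ≰⇒> (¬fits ∘ inj₂)
  B≤p : B ≤ suc p
  B≤p = suc[m]*n≤o*m⇒n≤o (begin
    suc A * B             ≤⟨ *-monoˡ-≤ B (≰⇒> (¬fits ∘ inj₁)) ⟩
    count b B * B         ≤⟨ count*≤Σ (suc q) b B ⟩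
    Σ[ suc q ] b          ≡⟨ balanced ⟨
    Σ[ suc p ] a          ≤⟨ Σ-mono-≤ (suc p) a≤A ⟩
    Σ[ suc p ] (λ _ → A)  ≡⟨ Σ-const (suc p) A ⟩
    suc p * A             ∎)

argmax : ∀ {n} (f : Fin (suc n) → ℕ) → ∃[ i ] (∀ k → f k ≤ f i)
argmax {zero}  f = zero , λ { zero → ≤-refl }
argmax {suc n} f with argmax (f ∘ suc)
... | i , f∘suc≤ with f (suc i) ≤? f zero
...   | yes fi≤f0 = zero , λ { zero → ≤-refl ; (suc k) → ≤-trans (f∘suc≤ k) fi≤f0 }
...   | no fi≰f0  = suc i , λ { zero → <⇒≤ (≰⇒> fi≰f0) ; (suc k) → f∘suc≤ k }

positiveStep : ∀ {t p q} → AdmissibleRealizable t p (suc q) → AdmissibleRealizable t q (suc p) →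
               (I : Admissible t (suc p) (suc q)) → let open Admissible I in
               ∀ i → a i ≡ A → ∀ j → b j ≡ B → (∀ i → 0 < a i) → (∀ j → 0 < b j) →
               Realizable t a b
positiveStep {t} {p} {q} ihRow ihCol I i ai≡A j bj≡B a>0 b>0 with A ≤? suc q | B ≤? suc p
  where open Admissible I
... | yes A≤q | _       = removeMaxRowOrColumn ihRow ihCol I i ai≡A j bj≡B a>0 b>0 A≤q
... | no _    | yes B≤p = Realizable-transpose
  (removeMaxRowOrColumn ihCol ihRow (swap I) j bj≡B i ai≡A b>0 a>0 B≤p)
... | no A≰q  | no B≰p  = large⇒realizable I (≰⇒> A≰q) (≰⇒> B≰p)

inductionStep : ∀ {t p q} → AdmissibleRealizable t p (suc q) → AdmissibleRealizable t q (suc p) →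
                AdmissibleRealizable t (suc p) (suc q)
inductionStep ihRow ihCol I with any? (λ i → a i ≟ 0) | any? (λ j → b j ≟ 0)
  where open Admissible I
... | yes (i , ai≡0) | _              = removeZeroRow ihRow I i ai≡0
... | no _           | yes (j , bj≡0) = Realizable-transpose (removeZeroRow ihCol (swap I) j bj≡0)
... | no a≢0         | no b≢0 with argmax (Admissible.a I) | argmax (Admissible.b I)
...   | i , a≤ai | j , b≤bj =
  positiveStep ihRow ihCol (tighten I i a≤ai j b≤bj) i refl j refl
               (λ k → n≢0⇒n>0 (a≢0 ∘ (k ,_))) (λ k → n≢0⇒n>0 (b≢0 ∘ (k ,_)))

noRows⇒realizable : ∀ {t q} → AdmissibleRealizable t 0 q
noRows⇒realizable {q = q} I with realize 0 q a b balanced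
  where open Admissible I
... | M , realizes = M , realizes , z≤n

admissible⇒realizable : ∀ {t} n {p q} → p + q ≤ n → AdmissibleRealizable t p q
admissible⇒realizable _       {zero}          _ = noRows⇒realizable
admissible⇒realizable _       {suc p} {zero}  _ = Realizable-transpose ∘ noRows⇒realizable ∘ swap
admissible⇒realizable zero    {suc p} {suc q} ()
admissible⇒realizable (suc n) {suc p} {suc q} (s≤s p+q≤n) =
  inductionStep (admissible⇒realizable n p+q≤n) (admissible⇒realizable n q+p≤n)
  where
  q+p≤n : q + suc p ≤ n
  q+p≤n = subst (_≤ n) (trans (+-comm p (suc q)) (sym (+-suc q p))) p+q≤n

Σ-lookup : ∀ xs → Σ[ length xs ] (lookup xs) ≡ sum xs
Σ-lookup xs = cong sum (tabulate-lookup xs)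

lookup≤first : ∀ {xs} → NonIncreasing xs → ∀ i → lookup xs i ≤ first xs
lookup≤first [-]           zero    = ≤-refl
lookup≤first (_ ∷ _)       zero    = ≤-refl
lookup≤first (x≥y ∷ y∷ys↓) (suc i) = ≤-trans (lookup≤first y∷ys↓ i) x≥y

sum[d]/2≡sum[a] : ∀ {d a b} → BP d a b → sum d / 2 ≡ sum a
sum[d]/2≡sum[a] {d} {a} {b} bp = begin
  sum d / 2            ≡⟨ cong (_/ 2) (trans (sum-↭ (toPermutation complementary)) (sum-++ a b)) ⟩
  (sum a + sum b) / 2  ≡⟨ cong (λ x → (sum a + x) / 2) equalSums ⟨
  (sum a + sum a) / 2  ≡⟨ cong (_/ 2) (trans (cong (sum a +_) (sym (+-identityʳ (sum a))))
                                             (*-comm 2 (sum a))) ⟩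
  sum a * 2 / 2        ≡⟨ m*n/n≡m (sum a) 2 ⟩
  sum a                ∎
  where
  open ≡-Reasoning
  open BP bp

lemma39 : (t : ℕ) → 1 ≤ t →
          (d : List ℕ) → DegreeSequence d →
          (a b : List ℕ) → BP d a b →
          NonIncreasing a → NonIncreasing b →
          first a * first b ≤ sum d / 2 + t + 1 →
          TotBigraphic t a b
lemma39 t _ d _ a b bp a↓ b↓ a₁*b₁≤ with admissible⇒realizable (length a + length b) ≤-refl I
  where
  I : Admissible t (length a) (length b)
  I = record
    { a = lookup a ; b = lookup b
    ; balanced = trans (Σ-lookup a) (trans (BP.equalSums bp) (sym (Σ-lookup b)))
    ; A = first a ; B = first b ; a≤A = lookup≤first a↓ ; b≤B = lookup≤first b↓
    ; A*B≤ = subst (λ x → first a * first b ≤ x + t + 1)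
                   (trans (sum[d]/2≡sum[a] bp) (sym (Σ-lookup a))) a₁*b₁≤ }
... | M , (degA≡ , degB≡) , excess≤ =
  M , degA≡ , degB≡ , subst (_≤ t) (sym (TotMult≡excess M)) excess≤
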